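{- Let $M$ be a matroid with rank function $r$, and let $A_1,A_2,\ldots,A_t$ be an antichain of cyclic flats of $M$ such that $(A_1\land A_2\land\cdots\land A_k)\lor A_{k+1}=A_k\lor A_{k+1}$ whenever $1\le k<t$, where meets and joins are taken in $\mathcal{Z}(M)$. Then for every $k$ with $1\le k\le t$, $$r(A_1\cap A_2\cap\cdots\cap A_k)\le \sum_{i=1}^k r(A_i)-\sum_{i=1}^{k-1} r(A_i\cup A_{i+1}).$$
   Context: All matroids are finite. A flat $X$ of $M$ is cyclic if $M|X$ has no isthmuses. The cyclic flats ordered by inclusion form a lattice $\mathcal{Z}(M)$, in which $A\lor B=\mathrm{cl}(A\cup B)$ and $A\land B$ is the union of the circuits of $M$ contained in $A\cap B$. -}

module Defs where

open import Data.Nat using (ℕ; zero; suc; _+_; _≤_; _<_; _≟_)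
open import Data.Fin using (Fin)
open import Data.Fin.Subset using (Subset; _∈_; _∉_; _⊆_; _⊂_; _∪_; _∩_; _─_; ∣_∣; ⁅_⁆)
open import Data.Fin.Subset.Properties using (_⊆?_; _⊂?_; _∈?_; anySubset?)
open import Data.Product using (_×_; Σ; _,_)
open import Data.Vec using (tabulate)
open import Relation.Nullary using (¬_; Dec; yes; no)
open import Relation.Nullary.Decidable using (⌊_⌋; _×-dec_; ¬?)
open import Relation.Binary.PropositionalEquality using (_≡_)
open import Data.Nat.Properties using (_<?_)

record Matroid (n : ℕ) : Set where
  field
    r          : Subset n → ℕ
    r-bound    : ∀ X → r X ≤ ∣ X ∣
    r-mono     : ∀ {X Y} → X ⊆ Y → r X ≤ r Y
    r-submod   : ∀ X Y → r (X ∪ Y) + r (X ∩ Y) ≤ r X + r Y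

module _ {n : ℕ} (M : Matroid n) where
  open Matroid M

  cl : Subset n → Subset n
  cl X = tabulate (λ e → ⌊ r (X ∪ ⁅ e ⁆) ≟ r X ⌋)

  IsFlat : Subset n → Set
  IsFlat X = cl X ≡ X

  IsIsthmusOf : Subset n → Fin n → Set
  IsIsthmusOf X e = e ∈ X × r (X ─ ⁅ e ⁆) < r X

  IsCyclicFlat : Subset n → Set
  IsCyclicFlat X = IsFlat X × (∀ e → ¬ IsIsthmusOf X e)

  Dependent : Subset n → Set
  Dependent X = r X < ∣ X ∣

  Independent : Subset n → Set
  Independent X = r X ≡ ∣ X ∣

  IsCircuit : Subset n → Set
  IsCircuit C = Dependent C × (∀ D → D ⊂ C → Independent D)

  dependent? : ∀ X → Dec (Dependent X)
  dependent? X = r X <? ∣ X ∣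

  isCircuit? : ∀ C → Dec (IsCircuit C)
  isCircuit? C with dependent? C | anySubset? {P = λ D → D ⊂ C × ¬ Independent D}
                                     (λ D → (D ⊂? C) ×-dec ¬? (r D ≟ ∣ D ∣))
  ... | no ¬d | _ = no (λ { (d , _) → ¬d d })
  ... | yes d | yes (D , D⊂C , ¬ind) = no (λ { (_ , h) → ¬ind (h D D⊂C) })
  ... | yes d | no ¬ex = yes (d , λ D D⊂C → decide D D⊂C)
    where
      decide : ∀ D → D ⊂ C → Independent D
      decide D D⊂C with r D ≟ ∣ D ∣
      ... | yes eq = eq
      ... | no neq = Data.Empty.⊥-elim (¬ex (D , D⊂C , neq))
        where import Data.Empty

  _∨ᶻ_ : Subset n → Subset n → Subset n
  A ∨ᶻ B = cl (A ∪ B)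

  -- meet in Z(M): union of the circuits of M contained in A ∩ B
  _∧ᶻ_ : Subset n → Subset n → Subset n
  A ∧ᶻ B = tabulate (λ e → ⌊ anySubset? {P = λ C → IsCircuit C × C ⊆ A ∩ B × e ∈ C}
                              (λ C → isCircuit? C ×-dec ((C ⊆? (A ∩ B)) ×-dec (e ∈? C))) ⌋)

-- Indexing is 0-based: A 0, ..., A (t-1) stand for the paper's A_1, ..., A_t.

meetUpTo : ∀ {n} → Matroid n → (ℕ → Subset n) → ℕ → Subset n
meetUpTo M A zero = A zero
meetUpTo M A (suc k) = _∧ᶻ_ M (meetUpTo M A k) (A (suc k))

interUpTo : ∀ {n} → (ℕ → Subset n) → ℕ → Subset n
interUpTo A zero = A zero
interUpTo A (suc k) = interUpTo A k ∩ A (suc k)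

sumBelow : (ℕ → ℕ) → ℕ → ℕ
sumBelow f zero = zero
sumBelow f (suc k) = sumBelow f k + f k

-- Passing to the closure does not change rank, so the hypothesis
-- cl ((A₀ ∧ ⋯ ∧ Aₖ) ∪ Aₖ₊₁) = cl (Aₖ ∪ Aₖ₊₁) together with A₀ ∧ ⋯ ∧ Aₖ ⊆ A₀ ∩ ⋯ ∩ Aₖ =: Iₖ
-- gives r (Aₖ ∪ Aₖ₊₁) ≤ r (Iₖ ∪ Aₖ₊₁). Submodularity applied to Iₖ and Aₖ₊₁ then yields
-- r (Iₖ₊₁) + r (Aₖ ∪ Aₖ₊₁) ≤ r (Iₖ) + r (Aₖ₊₁), and these inequalities telescope.
module Submission where

open import Defs
open import Data.Nat using (ℕ; zero; suc; _+_; _≤_; _<_; s≤s)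
open import Data.Nat.Properties
  using (≤-reflexive; ≤-trans; ≤-antisym; +-comm; +-mono-≤; +-monoˡ-≤; +-monoʳ-≤; +-cancelʳ-≤; n<1+n; <-trans; +-commutativeSemigroup; module ≤-Reasoning)
open import Algebra.Properties.CommutativeSemigroup +-commutativeSemigroup using (x∙yz≈xz∙y; xy∙z≈xz∙y)
open import Data.Bool using (Bool; T)
open import Data.Bool.Properties using (T-≡)
open import Data.Fin using (Fin)
open import Data.Fin.Subset using (Subset; _∈_; _⊆_; _∪_; _∩_; ⁅_⁆; ⋃)
open import Data.Fin.Subset.Properties
  using (_∈?_; x∈⁅x⁆; x∈⁅y⁆⇒x≡y; x∈p∪q⁺; x∈p∪q⁻; x∈p∩q⁺; x∈p∩q⁻; p⊆p∪q; q⊆p∪q; ∪-assoc; ∪-identityʳ)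
open import Data.List using ([]; _∷_; map; filter; allFin)
open import Data.List.Relation.Unary.All using (All; []; _∷_)
open import Data.List.Relation.Unary.All.Properties using (all-filter)
open import Data.List.Relation.Unary.Any using (here; there)
import Data.List.Membership.Propositional as List
open import Data.List.Membership.Propositional.Properties using (∈-allFin; ∈-filter⁺)
open import Data.Product using (_,_)
open import Data.Sum using (inj₁; inj₂; [_,_])
open import Data.Vec using (tabulate)
open import Data.Vec.Properties using (lookup∘tabulate; []=⇒lookup; lookup⇒[]=)
open import Function using (_∘_; id; Equivalence)
open import Relation.Nullary using (¬_)
open import Relation.Nullary.Decidable using (toWitness; fromWitness)
open import Relation.Binary.PropositionalEquality using (_≡_; _≢_; refl; sym; trans; cong; subst)

∈-tabulate⁻ : ∀ {n} (f : Fin n → Bool) {x} → x ∈ tabulate f → T (f x)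
∈-tabulate⁻ f {x} x∈ = Equivalence.from T-≡ (trans (sym (lookup∘tabulate f x)) ([]=⇒lookup x∈))

∈-tabulate⁺ : ∀ {n} (f : Fin n → Bool) {x} → T (f x) → x ∈ tabulate f
∈-tabulate⁺ f {x} fx = lookup⇒[]= x (tabulate f) (trans (lookup∘tabulate f x) (Equivalence.to T-≡ fx))

x∈⋃⁅xs⁆ : ∀ {n} {x : Fin n} {xs} → x List.∈ xs → x ∈ ⋃ (map ⁅_⁆ xs)
x∈⋃⁅xs⁆ {x = x} (here refl) = p⊆p∪q _ (x∈⁅x⁆ x)
x∈⋃⁅xs⁆ (there x∈xs)        = q⊆p∪q _ _ (x∈⋃⁅xs⁆ x∈xs)

module _ {n : ℕ} (M : Matroid n) where
  open Matroid M

  ∈-cl⁻ : ∀ {Y x} → x ∈ cl M Y → r (Y ∪ ⁅ x ⁆) ≡ r Y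
  ∈-cl⁻ = toWitness ∘ ∈-tabulate⁻ _

  ∈-cl⁺ : ∀ {Y x} → r (Y ∪ ⁅ x ⁆) ≡ r Y → x ∈ cl M Y
  ∈-cl⁺ = ∈-tabulate⁺ _ ∘ fromWitness

  ⊆-cl : ∀ Y → Y ⊆ cl M Y
  ⊆-cl Y {x} x∈Y = ∈-cl⁺ (≤-antisym (r-mono Y∪x⊆Y) (r-mono (p⊆p∪q ⁅ x ⁆)))
    where
    Y∪x⊆Y : Y ∪ ⁅ x ⁆ ⊆ Y
    Y∪x⊆Y z∈ = [ id , (λ z∈x → subst (_∈ Y) (sym (x∈⁅y⁆⇒x≡y x z∈x)) x∈Y) ] (x∈p∪q⁻ Y ⁅ x ⁆ z∈)

  r-∪-spanned : ∀ {Y X e} → Y ⊆ X → e ∈ cl M Y → r (X ∪ ⁅ e ⁆) ≤ r X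
  r-∪-spanned {Y} {X} {e} Y⊆X e∈clY = +-cancelʳ-≤ (r Y) _ _ (begin
    r (X ∪ ⁅ e ⁆) + r Y       ≤⟨ +-mono-≤ (r-mono X∪e⊆X∪Ye) (r-mono Y⊆X∩Ye) ⟩
    r (X ∪ Ye) + r (X ∩ Ye)   ≤⟨ r-submod X Ye ⟩
    r X + r Ye                ≡⟨ cong (r X +_) (∈-cl⁻ e∈clY) ⟩
    r X + r Y                 ∎)
    where
    open ≤-Reasoning
    Ye = Y ∪ ⁅ e ⁆
    X∪e⊆X∪Ye : X ∪ ⁅ e ⁆ ⊆ X ∪ Ye
    X∪e⊆X∪Ye z∈ = x∈p∪q⁺ ([ inj₁ , inj₂ ∘ q⊆p∪q Y ⁅ e ⁆ ] (x∈p∪q⁻ X ⁅ e ⁆ z∈))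
    Y⊆X∩Ye : Y ⊆ X ∩ Ye
    Y⊆X∩Ye z∈ = x∈p∩q⁺ (Y⊆X z∈ , p⊆p∪q ⁅ e ⁆ z∈)

  r-∪-⋃-spanned : ∀ {Y X} es → Y ⊆ X → All (_∈ cl M Y) es → r (X ∪ ⋃ (map ⁅_⁆ es)) ≤ r X
  r-∪-⋃-spanned {X = X} []       _   []         = ≤-reflexive (cong r (∪-identityʳ X))
  r-∪-⋃-spanned {X = X} (e ∷ es) Y⊆X (e∈ ∷ es∈) = begin
    r (X ∪ (⁅ e ⁆ ∪ U))   ≡⟨ cong r (sym (∪-assoc X ⁅ e ⁆ U)) ⟩
    r ((X ∪ ⁅ e ⁆) ∪ U)   ≤⟨ r-∪-⋃-spanned es (p⊆p∪q ⁅ e ⁆ ∘ Y⊆X) es∈ ⟩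
    r (X ∪ ⁅ e ⁆)         ≤⟨ r-∪-spanned Y⊆X e∈ ⟩
    r X                   ∎
    where
    open ≤-Reasoning
    U = ⋃ (map ⁅_⁆ es)

  r-cl : ∀ Y → r (cl M Y) ≡ r Y
  r-cl Y = ≤-antisym (begin
    r (cl M Y)         ≤⟨ r-mono clY⊆Y∪spanned ⟩
    r (Y ∪ spanned)    ≤⟨ r-∪-⋃-spanned es (λ y∈ → y∈) (all-filter (_∈? cl M Y) (allFin n)) ⟩
    r Y                ∎) (r-mono (⊆-cl Y))
    where
    open ≤-Reasoning
    es = filter (_∈? cl M Y) (allFin n)
    spanned = ⋃ (map ⁅_⁆ es)
    clY⊆Y∪spanned : cl M Y ⊆ Y ∪ spanned
    clY⊆Y∪spanned {x} x∈ = q⊆p∪q Y spanned (x∈⋃⁅xs⁆ (∈-filter⁺ (_∈? cl M Y) (∈-allFin x) x∈))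

  cl-≡⇒r-≡ : ∀ {X Y} → cl M X ≡ cl M Y → r X ≡ r Y
  cl-≡⇒r-≡ {X} {Y} eq = trans (sym (r-cl X)) (trans (cong r eq) (r-cl Y))

  ∧ᶻ-⊆-∩ : ∀ A B → _∧ᶻ_ M A B ⊆ A ∩ B
  ∧ᶻ-⊆-∩ A B x∈ with toWitness (∈-tabulate⁻ _ x∈)
  ... | C , _ , C⊆A∩B , x∈C = C⊆A∩B x∈C

  meetUpTo-⊆-interUpTo : ∀ A k → meetUpTo M A k ⊆ interUpTo A k
  meetUpTo-⊆-interUpTo A zero    x∈ = x∈
  meetUpTo-⊆-interUpTo A (suc k) x∈ with x∈p∩q⁻ _ _ (∧ᶻ-⊆-∩ (meetUpTo M A k) (A (suc k)) x∈)
  ... | x∈meet , x∈A = x∈p∩q⁺ (meetUpTo-⊆-interUpTo A k x∈meet , x∈A)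

  r-∩-+-≤ : ∀ {I B C} → r C ≤ r (I ∪ B) → r (I ∩ B) + r C ≤ r I + r B
  r-∩-+-≤ {I} {B} {C} rC≤ = begin
    r (I ∩ B) + r C         ≤⟨ +-monoʳ-≤ (r (I ∩ B)) rC≤ ⟩
    r (I ∩ B) + r (I ∪ B)   ≡⟨ +-comm (r (I ∩ B)) (r (I ∪ B)) ⟩
    r (I ∪ B) + r (I ∩ B)   ≤⟨ r-submod I B ⟩
    r I + r B               ∎
    where open ≤-Reasoning

  r-interUpTo-step : ∀ (A : ℕ → Subset n) k
    → _∨ᶻ_ M (meetUpTo M A k) (A (suc k)) ≡ _∨ᶻ_ M (A k) (A (suc k))
    → r (interUpTo A (suc k)) + r (A k ∪ A (suc k)) ≤ r (interUpTo A k) + r (A (suc k))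
  r-interUpTo-step A k join-eq = r-∩-+-≤ (begin
    r (A k ∪ A (suc k))                  ≡⟨ cl-≡⇒r-≡ (sym join-eq) ⟩
    r (meetUpTo M A k ∪ A (suc k))       ≤⟨ r-mono meet∪A⊆inter∪A ⟩
    r (interUpTo A k ∪ A (suc k))        ∎)
    where
    open ≤-Reasoning
    meet∪A⊆inter∪A : meetUpTo M A k ∪ A (suc k) ⊆ interUpTo A k ∪ A (suc k)
    meet∪A⊆inter∪A x∈ = x∈p∪q⁺ ([ inj₁ ∘ meetUpTo-⊆-interUpTo A k , inj₂ ] (x∈p∪q⁻ _ _ x∈))

  r-interUpTo-≤ : ∀ (A : ℕ → Subset n) k
    → (∀ j → j < k → _∨ᶻ_ M (meetUpTo M A j) (A (suc j)) ≡ _∨ᶻ_ M (A j) (A (suc j)))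
    → r (interUpTo A k) + sumBelow (λ i → r (A i ∪ A (suc i))) k ≤ sumBelow (λ i → r (A i)) (suc k)
  r-interUpTo-≤ A zero    _        = ≤-reflexive (+-comm (r (A zero)) 0)
  r-interUpTo-≤ A (suc k) join-eqs =
    +-telescope (r (interUpTo A (suc k))) (r (A k ∪ A (suc k)))
                (r-interUpTo-step A k (join-eqs k (n<1+n k)))
                (r-interUpTo-≤ A k (λ j j<k → join-eqs j (<-trans j<k (n<1+n k))))
    where
    +-telescope : ∀ a c {i b s f} → a + c ≤ i + b → i + s ≤ f → a + (s + c) ≤ f + b
    +-telescope a c {i} {b} {s} {f} a+c≤i+b i+s≤f = begin
      a + (s + c)   ≡⟨ x∙yz≈xz∙y a s c ⟩
      (a + c) + s   ≤⟨ +-monoˡ-≤ s a+c≤i+b ⟩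
      (i + b) + s   ≡⟨ xy∙z≈xz∙y i b s ⟩
      (i + s) + b   ≤⟨ +-monoˡ-≤ b i+s≤f ⟩
      f + b         ∎
      where open ≤-Reasoning

lemma3p6 : ∀ {n} (M : Matroid n) (t : ℕ) (A : ℕ → Subset n)
    → (∀ i → i < t → IsCyclicFlat M (A i))
    → (∀ i j → i < t → j < t → i ≢ j → ¬ (A i ⊆ A j))
    → (∀ k → suc k < t → _∨ᶻ_ M (meetUpTo M A k) (A (suc k)) ≡ _∨ᶻ_ M (A k) (A (suc k)))
    → ∀ k → k < t
    → Matroid.r M (interUpTo A k) + sumBelow (λ i → Matroid.r M (A i ∪ A (suc i))) k
    ≤ sumBelow (λ i → Matroid.r M (A i)) (suc k)
lemma3p6 M t A _ _ join-eqs k k<t =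
  r-interUpTo-≤ M A k (λ j j<k → join-eqs j (≤-trans (s≤s j<k) k<t))
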